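{- Let $\alpha\ge1$, let $L=\lceil\log_2 n\rceil$, and let $\mathcal{H}=(P\cup R,\mathcal{C})$ be a weighted hypergraph in which every configuration $C$ contains exactly one player, every resource $j\in C$ has weight $w_{j,C}$ that is a power of $2$ with $1/(2n)\le w_{j,C}\le \frac{5}{100\alpha}$, and $\sum_{j\in C}w_{j,C}=1$. Construct $\mathcal{H}'=(P'\cup R,\mathcal{C}')$ by replacing each player $i\in P$ by a group of players $i_1,\dots,i_L$, and each configuration $C$ containing $i$ by the set $\mathcal{S}_C=\{C_1,\dots,C_L\}$, where $C_s$ contains player $i_s$ and all resources $j\in C$ with $w_{j,C}=2^{ -(s+1)}$. Then a consistent $\alpha$-relaxed perfect matching in $\mathcal{H}'$ induces an $O(\alpha)$-relaxed perfect matching in $\mathcal{H}$.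
   Context: Here $n=|R|$. An $\alpha$-relaxed perfect matching in a weighted hypergraph $\mathcal{H}$ (each configuration containing exactly one player, with weights $w_{j,C}\ge0$) selects for each player $i$ a configuration $C\ni i$ and assigns to $i$ a subset of $C\cap R$ of total weight at least $(1/\alpha)\sum_{j\in C}w_{j,C}$, with no resource assigned to more than one player. In $\mathcal{H}'$ the resources are unweighted. A consistent $\alpha$-relaxed perfect matching in $\mathcal{H}'$ selects, for each group $\{i_1,\dots,i_L\}$ (coming from player $i$), the set $\mathcal{S}_C$ for a single configuration $C\ni i$ of $\mathcal{H}$, and assigns to each player $i_s$ at least $\lfloor |C_s\cap R|/\alpha\rfloor$ resources of $C_s$, with no resource assigned to more than one player.
   Formalization: The parameter α ranges over the rationals with α ≥ 1. -}

module Defs where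

open import Data.Nat as ℕ using (ℕ; zero; suc; _^_)
open import Data.Nat.Properties using (m^n≢0)
open import Data.Nat.Logarithm using (⌈log₂_⌉)
open import Data.Integer as ℤ using (ℤ; +_)
open import Data.Rational as ℚ using (ℚ; mkℚ; 0ℚ; 1ℚ; _/_; _÷_; _*_; _+_; _≤_; ≢-nonZero; floor)
open import Data.Rational.Properties using (_≟_)
open import Data.Bool using (Bool; true; false; _∧_)
open import Data.Vec using (Vec; []; _∷_; lookup; tabulate)
open import Data.Fin using (Fin; toℕ) renaming (zero to fzero; suc to fsuc)
open import Data.Fin.Subset using (Subset; _∈_; _⊆_; _∩_; ∣_∣; Empty)
open import Data.Product using (_×_; _,_; ∃-syntax)
open import Function using (_∘_)
import Data.Nat.Coprimality as C
open import Relation.Nullary using (yes; no; ¬_)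
open import Relation.Nullary.Decidable using (does)
open import Relation.Binary.PropositionalEquality using (_≡_; _≢_)

ℕ→ℚ : ℕ → ℚ
ℕ→ℚ m = mkℚ (+ m) 0 (C.sym (C.1-coprimeTo m))

-- Total division on ℚ: x ÷ᵣ y = x / y for y ≠ 0 (junk value 0 for y = 0;
-- it is only ever used with nonzero divisors below, e.g. α ≥ 1).
_÷ᵣ_ : ℚ → ℚ → ℚ
x ÷ᵣ y with y ≟ 0ℚ
... | yes _ = 0ℚ
... | no y≢0 = _÷_ x y {{≢-nonZero y≢0}}

pow2inv : ℕ → ℚ
pow2inv k = _/_ (+ 1) (2 ^ k) {{m^n≢0 2 k}}

IsPowerOfTwo : ℚ → Set
IsPowerOfTwo x = ∃[ k ] (x ≡ pow2inv k)

wsum : ∀ {n} → Subset n → (Fin n → ℚ) → ℚ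
wsum [] f = 0ℚ
wsum (true ∷ s) f = f fzero + wsum s (f ∘ fsuc)
wsum (false ∷ s) f = wsum s (f ∘ fsuc)

-- Every configuration contains exactly one player (player c) and the
-- resources res c ⊆ R; weight c j is w_{j,C} (meaningful for j ∈ res c).
record WHypergraph (n : ℕ) : Set where
  field
    nP nC  : ℕ
    player : Fin nC → Fin nP
    res    : Fin nC → Subset n
    weight : Fin nC → Fin n → ℚ

record UHypergraph (n : ℕ) : Set₁ where
  field
    Player Config : Set
    player : Config → Player
    res    : Config → Subset n

L : ℕ → ℕ
L n = ⌈log₂ n ⌉

-- The construction of H′: player i ↦ group (i , s), s : Fin L standing for
-- index s+1 ∈ {1,…,L}; configuration C ↦ C_s = (C , s) containing player
-- (i , s) and the resources j ∈ C with w_{j,C} = 2^{-((s+1)+1)}.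
H′ : ∀ {n} → WHypergraph n → UHypergraph n
H′ {n} H = record
  { Player = Fin nP × Fin (L n)
  ; Config = Fin nC × Fin (L n)
  ; player = λ { (c , s) → (player c , s) }
  ; res    = λ { (c , s) → tabulate λ j →
                   lookup (res c) j ∧ does (weight c j ≟ pow2inv (suc (suc (toℕ s)))) }
  }
  where open WHypergraph H

record RelaxedPM {n} (H : WHypergraph n) (α : ℚ) : Set where
  open WHypergraph H
  field
    choice        : Fin nP → Fin nC
    choice-player : ∀ i → player (choice i) ≡ i
    assign        : Fin nP → Subset n
    assign-⊆      : ∀ i → assign i ⊆ res (choice i)
    assign-weight : ∀ i → (wsum (res (choice i)) (weight (choice i))) ÷ᵣ α
                            ≤ wsum (assign i) (weight (choice i))
    disjoint      : ∀ i i′ → i ≢ i′ → Empty (assign i ∩ assign i′)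

-- Consistent α-relaxed perfect matching in H′ = H′ H: for each group
-- {i_1,…,i_L} (coming from player i of H) a single configuration C ∋ i of H
-- is chosen, player i_s gets configuration C_s, and is assigned at least
-- ⌊|C_s ∩ R| / α⌋ resources of C_s; assigned sets are pairwise disjoint.
record ConsistentRelaxedPM {n} (H : WHypergraph n) (α : ℚ) : Set where
  open WHypergraph H using (nP; nC; player)
  module H′H = UHypergraph (H′ H)
  field
    choice        : Fin nP → Fin nC
    choice-player : ∀ i → player (choice i) ≡ i
    assign        : H′H.Player → Subset n
    assign-⊆      : ∀ i s → assign (i , s) ⊆ H′H.res (choice i , s)
    assign-size   : ∀ i s → floor (ℕ→ℚ ∣ H′H.res (choice i , s) ∣ ÷ᵣ α)
                              ℤ.≤ + ∣ assign (i , s) ∣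
    disjoint      : ∀ p q → p ≢ q → Empty (assign p ∩ assign q)

WellFormed : ∀ {n} → ℚ → WHypergraph n → Set
WellFormed {n} α H =
    (∀ c j → j ∈ res c →
        IsPowerOfTwo (weight c j)
      × (1ℚ ÷ᵣ ℕ→ℚ (2 ℕ.* n) ≤ weight c j)
      × (weight c j ≤ ℕ→ℚ 5 ÷ᵣ (ℕ→ℚ 100 * α)))
  × (∀ c → wsum (res c) (weight c) ≡ 1ℚ)
  where open WHypergraph H

Induces : ∀ {n} {H : WHypergraph n} {α β : ℚ} →
          ConsistentRelaxedPM H α → RelaxedPM H β → Set
Induces {n} {H} M′ M =
    (∀ i → RelaxedPM.choice M i ≡ ConsistentRelaxedPM.choice M′ i)
  × (∀ i j → j ∈ RelaxedPM.assign M i →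
       ∃[ s ] (j ∈ ConsistentRelaxedPM.assign M′ (i , s)))

module Submission where

-- Fix a player and its chosen configuration C, of total weight 1. Every weight of C is some
-- 2^-k with 2 ≤ k ≤ L + 1, so C is the disjoint union of the weight classes C_s of weight
-- 2^-(s+2) and 1 = Σ_s |C_s| 2^-(s+2). Member s of the player's group receives at least
-- ⌊|C_s|/α⌋ > |C_s|/α - 1 resources of C_s; handing the player the union of its group's
-- resources therefore loses, besides the factor α, at most the weight of one resource per
-- nonempty class. Nonempty classes have weight at most 5/(100α) and these weights halve from
-- class to class, so the losses total at most 10/(100α): the player keeps at least
-- (1 - 1/10)/α ≥ 1/(2α).

open import Algebra.Bundles using (Ring)
open import Data.Bool using (Bool; true; false; T; if_then_else_; _∧_)
open import Data.Bool.Properties using (T-≡; T-∧)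
open import Data.Empty using (⊥-elim)
open import Data.Fin using (Fin; toℕ; fromℕ<) renaming (zero to fzero; suc to fsuc)
import Data.Fin.Properties as Fin
open import Data.Fin.Subset using (Subset; _∈_; _⊆_; _∩_; _∪_; ⊥; ∣_∣; Empty)
open import Data.Fin.Subset.Properties
  using (x∈p∪q⁺; x∈p∪q⁻; x∈p∩q⁺; x∈p∩q⁻; ∉⊥; drop-∷-Empty; ⊆-antisym; nonempty?; Empty-unique; ∣⊥∣≡0)
open import Data.Integer as ℤ using (+_)
open import Data.Integer.DivMod using (div-pos-is-/ℕ; n<s[n/ℕd]*d)
open import Data.Integer.GCD using (gcd-zeroˡ)
import Data.Integer.Properties as ℤP
open import Data.Nat as ℕ using (ℕ; zero; suc; _^_; z≤n; s≤s)
open import Data.Nat.Logarithm using (⌈log₂_⌉; ⌈log₂⌉-mono-≤; ⌈log₂2*n⌉≡1+⌈log₂n⌉; ⌈log₂2^n⌉≡n)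
import Data.Nat.Properties as ℕP
import Data.Product as Product
open import Data.Product using (_×_; _,_; ∃-syntax; Σ-syntax; proj₁; proj₂)
open import Data.Rational as ℚ using (ℚ; mkℚ; 0ℚ; 1ℚ; _+_; _*_; _≤_; _<_; ↥_; ↧_; *≤*; *<*)
import Data.Rational.Properties as ℚP
open import Data.Rational.Solver using (module +-*-Solver)
import Data.Rational.Unnormalised as ℚᵘ
import Data.Rational.Unnormalised.Properties as ℚᵘP
open import Data.Sum using (inj₁; inj₂)
open import Data.Vec using ([]; _∷_; here; there; lookup; tabulate)
open import Data.Vec.Properties using (lookup∘tabulate; []=⇒lookup; lookup⇒[]=)
open import Function using (_∘_; id)
open import Function.Bundles using (module Equivalence)
open import Relation.Binary.PropositionalEquality
open import Relation.Nullary using (yes; no)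
open import Relation.Nullary.Decidable using (Dec; does; dec-true; from-no)
open import Relation.Nullary.Negation using (contradiction)

open import Defs
open import Algebra.Properties.Semiring.Sum (Ring.semiring ℚP.+-*-ring)
  using (sum-syntax; ∑-distrib-+; sum-cong-≗; *-distribˡ-sum)

open +-*-Solver

ℕ→ℚ-+ : ∀ a b → ℕ→ℚ (a ℕ.+ b) ≡ ℕ→ℚ a + ℕ→ℚ b
ℕ→ℚ-+ a b = ℚP.toℚᵘ-injective
  (ℚᵘP.≃-trans (ℚᵘ.*≡* numerators) (ℚᵘP.≃-sym (ℚP.toℚᵘ-homo-+ (ℕ→ℚ a) (ℕ→ℚ b))))
  where
  numerators : + (a ℕ.+ b) ℤ.* + 1 ≡ (+ a ℤ.* + 1 ℤ.+ + b ℤ.* + 1) ℤ.* + 1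
  numerators = cong (ℤ._* + 1) (trans (ℤP.pos-+ a b) (sym (cong₂ ℤ._+_ (ℤP.*-identityʳ (+ a)) (ℤP.*-identityʳ (+ b)))))

ℕ→ℚ-* : ∀ a b → ℕ→ℚ (a ℕ.* b) ≡ ℕ→ℚ a * ℕ→ℚ b
ℕ→ℚ-* a b = ℚP.toℚᵘ-injective
  (ℚᵘP.≃-trans (ℚᵘ.*≡* numerators) (ℚᵘP.≃-sym (ℚP.toℚᵘ-homo-* (ℕ→ℚ a) (ℕ→ℚ b))))
  where
  numerators : + (a ℕ.* b) ℤ.* + 1 ≡ (+ a ℤ.* + b) ℤ.* + 1
  numerators = cong (ℤ._* + 1) (ℤP.pos-* a b)

ℕ→ℚ-mono-≤ : ∀ {a b} → a ℕ.≤ b → ℕ→ℚ a ≤ ℕ→ℚ b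
ℕ→ℚ-mono-≤ {a} {b} a≤b = *≤* (ℤP.*-monoʳ-≤-nonNeg (+ 1) (ℤ.+≤+ a≤b))

ℕ→ℚ-cancel-≤ : ∀ {a b} → ℕ→ℚ a ≤ ℕ→ℚ b → a ℕ.≤ b
ℕ→ℚ-cancel-≤ {a} {b} (*≤* a≤b) = ℤP.drop‿+≤+ (ℤP.*-cancelʳ-≤-pos (+ a) (+ b) (+ 1) a≤b)

ℕ→ℚ-nonNeg : ∀ a → 0ℚ ≤ ℕ→ℚ a
ℕ→ℚ-nonNeg a = ℕ→ℚ-mono-≤ z≤n

ℕ→ℚ-pos : ∀ a .{{_ : ℕ.NonZero a}} → 0ℚ < ℕ→ℚ a
ℕ→ℚ-pos (suc a) = *<* (ℤ.+<+ ℕ.z<s)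

1≤⇒pos : ∀ {α} → 1ℚ ≤ α → 0ℚ < α
1≤⇒pos 1≤α = ℚP.<-≤-trans (ℕ→ℚ-pos 1) 1≤α

*-pos : ∀ {p q} → 0ℚ < p → 0ℚ < q → 0ℚ < p * q
*-pos {p} {q} 0<p 0<q = ℚP.positive⁻¹ (p * q) {{ℚP.pos*pos⇒pos p {{ℚ.positive 0<p}} q {{ℚ.positive 0<q}}}}

*-nonNeg : ∀ {p q} → 0ℚ ≤ p → 0ℚ ≤ q → 0ℚ ≤ p * q
*-nonNeg {p} {q} 0≤p 0≤q =
  ℚP.nonNegative⁻¹ (p * q) {{ℚP.nonNeg*nonNeg⇒nonNeg p {{ℚ.nonNegative 0≤p}} q {{ℚ.nonNegative 0≤q}}}}

+-cancelʳ-≤ : ∀ {p q} r → p + r ≤ q + r → p ≤ q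
+-cancelʳ-≤ {p} {q} r p+r≤q+r = begin
  p                  ≡⟨ solve 2 (λ p r → p := p :+ r :+ :- r) refl p r ⟩
  p + r + ℚ.- r      ≤⟨ ℚP.+-monoˡ-≤ (ℚ.- r) p+r≤q+r ⟩
  q + r + ℚ.- r      ≡⟨ solve 2 (λ q r → q :+ r :+ :- r := q) refl q r ⟩
  q                  ∎
  where open ℚP.≤-Reasoning

module _ {x y : ℚ} (0<y : 0ℚ < y) where

  *-÷ᵣ-inverse : y * (x ÷ᵣ y) ≡ x
  *-÷ᵣ-inverse with y ℚP.≟ 0ℚ
  ... | yes y≡0 = ⊥-elim (ℚP.<-irrefl (sym y≡0) 0<y)
  ... | no y≢0 = begin
    y * (x * y⁻¹)  ≡⟨ solve 3 (λ y x z → y :* (x :* z) := x :* (y :* z)) refl y x y⁻¹ ⟩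
    x * (y * y⁻¹)  ≡⟨ cong (x *_) (ℚP.*-inverseʳ y {{ℚ.≢-nonZero y≢0}}) ⟩
    x * 1ℚ         ≡⟨ ℚP.*-identityʳ x ⟩
    x              ∎
    where
    open ≡-Reasoning
    y⁻¹ : ℚ
    y⁻¹ = ℚ.1/_ y {{ℚ.≢-nonZero y≢0}}

  private
    y-nonNeg : ℚ.NonNegative y
    y-nonNeg = ℚ.nonNegative (ℚP.<⇒≤ 0<y)

  ≤-÷ᵣ⇒*-≤ : ∀ {w} → w ≤ x ÷ᵣ y → y * w ≤ x
  ≤-÷ᵣ⇒*-≤ w≤x/y = ℚP.≤-trans (ℚP.*-monoˡ-≤-nonNeg y {{y-nonNeg}} w≤x/y) (ℚP.≤-reflexive *-÷ᵣ-inverse)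

  ÷ᵣ-≤⇒≤-* : ∀ {w} → x ÷ᵣ y ≤ w → x ≤ y * w
  ÷ᵣ-≤⇒≤-* x/y≤w = ℚP.≤-trans (ℚP.≤-reflexive (sym *-÷ᵣ-inverse)) (ℚP.*-monoˡ-≤-nonNeg y {{y-nonNeg}} x/y≤w)

  ≤-*⇒÷ᵣ-≤ : ∀ {w} → x ≤ y * w → x ÷ᵣ y ≤ w
  ≤-*⇒÷ᵣ-≤ x≤yw = ℚP.*-cancelˡ-≤-pos y {{ℚ.positive 0<y}} (ℚP.≤-trans (ℚP.≤-reflexive *-÷ᵣ-inverse) x≤yw)

  ÷ᵣ-nonNeg : 0ℚ ≤ x → 0ℚ ≤ x ÷ᵣ y
  ÷ᵣ-nonNeg 0≤x = ℚP.*-cancelˡ-≤-pos y {{ℚ.positive 0<y}}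
    (ℚP.≤-trans (ℚP.≤-reflexive (ℚP.*-zeroʳ y)) (ℚP.≤-trans 0≤x (ℚP.≤-reflexive (sym *-÷ᵣ-inverse))))

floor≤⇒≤suc : ∀ p a → ℚ.floor p ℤ.≤ + a → p ≤ ℕ→ℚ (suc a)
floor≤⇒≤suc (mkℚ n d _) a ⌊p⌋≤a = *≤* (begin
  n ℤ.* + 1                        ≡⟨ ℤP.*-identityʳ n ⟩
  n                                <⟨ n<s[n/ℕd]*d n (suc d) ⟩
  (+ 1 ℤ.+ n ℤ./ℕ suc d) ℤ.* + suc d ≤⟨ ℤP.*-monoʳ-≤-nonNeg (+ suc d) (ℤP.+-monoʳ-≤ (+ 1) ⌊p⌋≤a′) ⟩
  (+ 1 ℤ.+ + a) ℤ.* + suc d        ∎)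
  where
  open ℤP.≤-Reasoning
  ⌊p⌋≤a′ : n ℤ./ℕ suc d ℤ.≤ + a
  ⌊p⌋≤a′ = ℤP.≤-trans (ℤP.≤-reflexive (sym (div-pos-is-/ℕ n (suc d)))) ⌊p⌋≤a

↥-pow2inv : ∀ k → ↥ pow2inv k ≡ + 1
↥-pow2inv k = trans (sym (ℤP.*-identityʳ _))
  (trans (cong (↥ pow2inv k ℤ.*_) (sym (gcd-zeroˡ (+ 2 ^ k)))) (ℚP.↥-/ (+ 1) (2 ^ k) {{ℕP.m^n≢0 2 k}}))

↧-pow2inv : ∀ k → ↧ pow2inv k ≡ + 2 ^ k
↧-pow2inv k = trans (sym (ℤP.*-identityʳ _))
  (trans (cong (↧ pow2inv k ℤ.*_) (sym (gcd-zeroˡ (+ 2 ^ k)))) (ℚP.↧-/ (+ 1) (2 ^ k) {{ℕP.m^n≢0 2 k}}))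

unit-fraction-*-denominator : ∀ p m → ↥ p ≡ + 1 → ↧ p ≡ + m → p * ℕ→ℚ m ≡ 1ℚ
unit-fraction-*-denominator p@(mkℚ _ d _) .(suc d) refl refl =
  ℚP.toℚᵘ-injective (ℚᵘP.≃-trans (ℚP.toℚᵘ-homo-* p (ℕ→ℚ (suc d))) (ℚᵘ.*≡* (cong (λ x → + suc x) denominators)))
  where
  denominators : (d ℕ.+ 0) ℕ.* 1 ≡ d ℕ.* 1 ℕ.+ 0
  denominators = trans (ℕP.*-identityʳ _) (trans (ℕP.+-identityʳ d) (sym (trans (ℕP.+-identityʳ _) (ℕP.*-identityʳ d))))

pow2inv-*-2^ : ∀ k → pow2inv k * ℕ→ℚ (2 ^ k) ≡ 1ℚ
pow2inv-*-2^ k = unit-fraction-*-denominator (pow2inv k) (2 ^ k) (↥-pow2inv k) (↧-pow2inv k)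

pow2inv-nonNeg : ∀ k → 0ℚ ≤ pow2inv k
pow2inv-nonNeg k with pow2inv k | ↥-pow2inv k
... | mkℚ _ _ _ | refl = *≤* (ℤ.+≤+ z≤n)

pow2inv-injective : ∀ {k k′} → pow2inv k ≡ pow2inv k′ → k ≡ k′
pow2inv-injective {k} {k′} eq = begin
  k                 ≡⟨ ⌈log₂2^n⌉≡n k ⟨
  ⌈log₂ 2 ^ k ⌉     ≡⟨ cong ⌈log₂_⌉ 2^k≡2^k′ ⟩
  ⌈log₂ 2 ^ k′ ⌉    ≡⟨ ⌈log₂2^n⌉≡n k′ ⟩
  k′                ∎
  where
  open ≡-Reasoning
  2^k≡2^k′ : 2 ^ k ≡ 2 ^ k′
  2^k≡2^k′ = ℤP.+-injective (trans (sym (↧-pow2inv k)) (trans (cong ↧_ eq) (↧-pow2inv k′)))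

pow2inv-halves : ∀ k → pow2inv (suc k) + pow2inv (suc k) ≡ pow2inv k
pow2inv-halves k = begin
  h + h                          ≡⟨ ℚP.*-identityʳ (h + h) ⟨
  (h + h) * 1ℚ                   ≡⟨ cong ((h + h) *_) (pow2inv-*-2^ k) ⟨
  (h + h) * (u * P)              ≡⟨ solve 3 (λ u h P → (h :+ h) :* (u :* P) := u :* (h :* ((con 1ℚ :+ con 1ℚ) :* P))) refl u h P ⟩
  u * (h * ((1ℚ + 1ℚ) * P))      ≡⟨ cong (λ x → u * (h * x)) (ℕ→ℚ-* 2 (2 ^ k)) ⟨
  u * (h * ℕ→ℚ (2 ^ suc k))      ≡⟨ cong (u *_) (pow2inv-*-2^ (suc k)) ⟩
  u * 1ℚ                         ≡⟨ ℚP.*-identityʳ u ⟩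
  u                              ∎
  where
  open ≡-Reasoning
  u h P : ℚ
  u = pow2inv k
  h = pow2inv (suc k)
  P = ℕ→ℚ (2 ^ k)

pow2inv-scale : ∀ q k → q * pow2inv k * ℕ→ℚ (2 ^ k) ≡ q
pow2inv-scale q k = trans (ℚP.*-assoc q _ _) (trans (cong (q *_) (pow2inv-*-2^ k)) (ℚP.*-identityʳ q))

*-pow2inv-≤⇒≤-*-2^ : ∀ a b k → ℕ→ℚ a * pow2inv k ≤ ℕ→ℚ b → a ℕ.≤ b ℕ.* 2 ^ k
*-pow2inv-≤⇒≤-*-2^ a b k a/2^k≤b = ℕ→ℚ-cancel-≤ (begin
  ℕ→ℚ a                          ≡⟨ pow2inv-scale (ℕ→ℚ a) k ⟨
  ℕ→ℚ a * pow2inv k * ℕ→ℚ (2 ^ k) ≤⟨ ℚP.*-monoʳ-≤-nonNeg (ℕ→ℚ (2 ^ k)) {{ℚ.nonNegative (ℕ→ℚ-nonNeg _)}} a/2^k≤b ⟩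
  ℕ→ℚ b * ℕ→ℚ (2 ^ k)            ≡⟨ ℕ→ℚ-* b (2 ^ k) ⟨
  ℕ→ℚ (b ℕ.* 2 ^ k)              ∎)
  where open ℚP.≤-Reasoning

≤-*-pow2inv⇒*-2^-≤ : ∀ a b k → ℕ→ℚ a ≤ ℕ→ℚ b * pow2inv k → a ℕ.* 2 ^ k ℕ.≤ b
≤-*-pow2inv⇒*-2^-≤ a b k a≤b/2^k = ℕ→ℚ-cancel-≤ (begin
  ℕ→ℚ (a ℕ.* 2 ^ k)              ≡⟨ ℕ→ℚ-* a (2 ^ k) ⟩
  ℕ→ℚ a * ℕ→ℚ (2 ^ k)            ≤⟨ ℚP.*-monoʳ-≤-nonNeg (ℕ→ℚ (2 ^ k)) {{ℚ.nonNegative (ℕ→ℚ-nonNeg _)}} a≤b/2^k ⟩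
  ℕ→ℚ b * pow2inv k * ℕ→ℚ (2 ^ k) ≡⟨ pow2inv-scale (ℕ→ℚ b) k ⟩
  ℕ→ℚ b                          ∎)
  where open ℚP.≤-Reasoning

∑-mono-≤ : ∀ {m} {f g : Fin m → ℚ} → (∀ s → f s ≤ g s) → ∑[ s < m ] f s ≤ ∑[ s < m ] g s
∑-mono-≤ {zero} f≤g = ℚP.≤-refl
∑-mono-≤ {suc m} f≤g = ℚP.+-mono-≤ (f≤g fzero) (∑-mono-≤ (f≤g ∘ fsuc))

IsHalving : (ℕ → ℚ) → Set
IsHalving f = (∀ k → 0ℚ ≤ f k) × (∀ k → f (suc k) + f (suc k) ≡ f k)

IsHalving-suc : ∀ {f} → IsHalving f → IsHalving (f ∘ suc)
IsHalving-suc (nonNeg , halves) = nonNeg ∘ suc , halves ∘ suc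

∑-halving-≤ : ∀ {f} → IsHalving f → ∀ m → ∑[ s < m ] f (suc (toℕ s)) ≤ f 0
∑-halving-≤ (nonNeg , _) zero = nonNeg 0
∑-halving-≤ {f} h@(_ , halves) (suc m) = ℚP.≤-trans
  (ℚP.+-monoʳ-≤ (f 1) (∑-halving-≤ (IsHalving-suc h) m)) (ℚP.≤-reflexive (halves 0))

if-else-0-≤ : ∀ b {x} → 0ℚ ≤ x → (if b then x else 0ℚ) ≤ x
if-else-0-≤ true 0≤x = ℚP.≤-refl
if-else-0-≤ false 0≤x = 0≤x

-- The first selected term is at most t and the rest is a tail of the halving sum.
∑-selected-halving-≤ : ∀ {f} → IsHalving f → ∀ {m} (b : Fin m → Bool) {t} → 0ℚ ≤ t →
  (∀ s → T (b s) → f (toℕ s) ≤ t) → ∑[ s < m ] (if b s then f (toℕ s) else 0ℚ) ≤ t + t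
∑-selected-halving-≤ h {zero} b 0≤t selected≤t = ℚP.+-mono-≤ 0≤t 0≤t
∑-selected-halving-≤ {f} h@(nonNeg , _) {suc m} b 0≤t selected≤t with b fzero | selected≤t fzero
... | true | f₀≤t = ℚP.+-mono-≤ (f₀≤t _) (ℚP.≤-trans
  (∑-mono-≤ (λ s → if-else-0-≤ (b (fsuc s)) (nonNeg _))) (ℚP.≤-trans (∑-halving-≤ h m) (f₀≤t _)))
... | false | _ = ℚP.≤-trans (ℚP.≤-reflexive (ℚP.+-identityˡ _))
  (∑-selected-halving-≤ (IsHalving-suc h) (b ∘ fsuc) 0≤t (selected≤t ∘ fsuc))

⋃ᶠ : ∀ {m n} → (Fin m → Subset n) → Subset n
⋃ᶠ {zero} A = ⊥
⋃ᶠ {suc m} A = A fzero ∪ ⋃ᶠ (A ∘ fsuc)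

∈-⋃ᶠ⁺ : ∀ {m n} (A : Fin m → Subset n) {j} s → j ∈ A s → j ∈ ⋃ᶠ A
∈-⋃ᶠ⁺ A fzero j∈A₀ = x∈p∪q⁺ (inj₁ j∈A₀)
∈-⋃ᶠ⁺ A (fsuc s) j∈Aₛ = x∈p∪q⁺ (inj₂ (∈-⋃ᶠ⁺ (A ∘ fsuc) s j∈Aₛ))

∈-⋃ᶠ⁻ : ∀ {m n} (A : Fin m → Subset n) {j} → j ∈ ⋃ᶠ A → ∃[ s ] j ∈ A s
∈-⋃ᶠ⁻ {zero} A j∈⊥ = ⊥-elim (∉⊥ j∈⊥)
∈-⋃ᶠ⁻ {suc m} A j∈⋃A with x∈p∪q⁻ (A fzero) (⋃ᶠ (A ∘ fsuc)) j∈⋃A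
... | inj₁ j∈A₀ = fzero , j∈A₀
... | inj₂ j∈⋃A′ = Product.map fsuc id (∈-⋃ᶠ⁻ (A ∘ fsuc) j∈⋃A′)

PairwiseDisjoint : ∀ {m n} → (Fin m → Subset n) → Set
PairwiseDisjoint A = ∀ s s′ → s ≢ s′ → Empty (A s ∩ A s′)

wsum-∪ : ∀ {n} (p q : Subset n) (f : Fin n → ℚ) → Empty (p ∩ q) → wsum (p ∪ q) f ≡ wsum p f + wsum q f
wsum-∪ [] [] f _ = refl
wsum-∪ (true ∷ p) (true ∷ q) f p∩q-empty = ⊥-elim (p∩q-empty (fzero , here))
wsum-∪ (true ∷ p) (false ∷ q) f p∩q-empty =
  trans (cong (λ r → f fzero + r) (wsum-∪ p q (f ∘ fsuc) (drop-∷-Empty p∩q-empty)))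
        (sym (ℚP.+-assoc (f fzero) (wsum p (f ∘ fsuc)) (wsum q (f ∘ fsuc))))
wsum-∪ (false ∷ p) (true ∷ q) f p∩q-empty =
  trans (cong (λ r → f fzero + r) (wsum-∪ p q (f ∘ fsuc) (drop-∷-Empty p∩q-empty)))
        (solve 3 (λ x y z → x :+ (y :+ z) := y :+ (x :+ z)) refl (f fzero) (wsum p (f ∘ fsuc)) (wsum q (f ∘ fsuc)))
wsum-∪ (false ∷ p) (false ∷ q) f p∩q-empty = wsum-∪ p q (f ∘ fsuc) (drop-∷-Empty p∩q-empty)

wsum-⊥ : ∀ {n} (f : Fin n → ℚ) → wsum ⊥ f ≡ 0ℚ
wsum-⊥ {zero} f = refl
wsum-⊥ {suc n} f = wsum-⊥ (f ∘ fsuc)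

wsum-⋃ᶠ : ∀ {m n} (A : Fin m → Subset n) (f : Fin n → ℚ) → PairwiseDisjoint A →
          wsum (⋃ᶠ A) f ≡ ∑[ s < m ] wsum (A s) f
wsum-⋃ᶠ {zero} A f _ = wsum-⊥ f
wsum-⋃ᶠ {suc m} A f disjoint = begin
  wsum (A fzero ∪ ⋃ᶠ (A ∘ fsuc)) f              ≡⟨ wsum-∪ (A fzero) (⋃ᶠ (A ∘ fsuc)) f A₀∩⋃A′-empty ⟩
  wsum (A fzero) f + wsum (⋃ᶠ (A ∘ fsuc)) f      ≡⟨ cong (λ r → wsum (A fzero) f + r) (wsum-⋃ᶠ (A ∘ fsuc) f disjoint′) ⟩
  wsum (A fzero) f + ∑[ s < m ] wsum (A (fsuc s)) f ∎
  where
  open ≡-Reasoning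
  disjoint′ : PairwiseDisjoint (A ∘ fsuc)
  disjoint′ s s′ s≢s′ = disjoint (fsuc s) (fsuc s′) (s≢s′ ∘ Fin.suc-injective)
  A₀∩⋃A′-empty : Empty (A fzero ∩ ⋃ᶠ (A ∘ fsuc))
  A₀∩⋃A′-empty (j , j∈∩) with x∈p∩q⁻ (A fzero) (⋃ᶠ (A ∘ fsuc)) j∈∩
  ... | j∈A₀ , j∈⋃A′ with ∈-⋃ᶠ⁻ (A ∘ fsuc) j∈⋃A′
  ... | s , j∈Aₛ = disjoint fzero (fsuc s) (λ ()) (j , x∈p∩q⁺ (j∈A₀ , j∈Aₛ))

wsum-const : ∀ {n} (S : Subset n) (f : Fin n → ℚ) {x} → (∀ j → j ∈ S → f j ≡ x) → wsum S f ≡ ℕ→ℚ ∣ S ∣ * x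
wsum-const [] f {x} _ = sym (ℚP.*-zeroˡ x)
wsum-const (true ∷ S) f {x} f≡x = begin
  f fzero + wsum S (f ∘ fsuc)      ≡⟨ cong₂ _+_ (f≡x fzero here) (wsum-const S (f ∘ fsuc) (λ j → f≡x (fsuc j) ∘ there)) ⟩
  x + ℕ→ℚ ∣ S ∣ * x                ≡⟨ solve 2 (λ x c → x :+ c :* x := (con 1ℚ :+ c) :* x) refl x (ℕ→ℚ ∣ S ∣) ⟩
  (1ℚ + ℕ→ℚ ∣ S ∣) * x             ≡⟨ cong (_* x) (ℕ→ℚ-+ 1 ∣ S ∣) ⟨
  ℕ→ℚ (suc ∣ S ∣) * x              ∎
  where open ≡-Reasoning
wsum-const (false ∷ S) f f≡x = wsum-const S (f ∘ fsuc) (λ j → f≡x (fsuc j) ∘ there)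

∈⇒T-lookup : ∀ {n} {S : Subset n} {j} → j ∈ S → T (lookup S j)
∈⇒T-lookup j∈S = Equivalence.from T-≡ ([]=⇒lookup j∈S)

T-lookup⇒∈ : ∀ {n} {S : Subset n} {j} → T (lookup S j) → j ∈ S
T-lookup⇒∈ {S = S} {j} t = lookup⇒[]= j S (Equivalence.to T-≡ t)

∈-tabulate⁻ : ∀ {n} (f : Fin n → Bool) {j} → j ∈ tabulate f → T (f j)
∈-tabulate⁻ f {j} j∈ = subst T (lookup∘tabulate f j) (∈⇒T-lookup j∈)

∈-tabulate⁺ : ∀ {n} (f : Fin n → Bool) {j} → T (f j) → j ∈ tabulate f
∈-tabulate⁺ f {j} t = T-lookup⇒∈ (subst T (sym (lookup∘tabulate f j)) t)

T-does⁻ : ∀ {A : Set} (a? : Dec A) → T (does a?) → A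
T-does⁻ (yes a) _ = a

T-does⁺ : ∀ {A : Set} (a? : Dec A) → A → T (does a?)
T-does⁺ a? a = Equivalence.from T-≡ (dec-true a? a)

weightClass : ∀ {n} → Subset n → (Fin n → ℚ) → ℚ → Subset n
weightClass R w x = tabulate (λ j → lookup R j ∧ does (w j ℚP.≟ x))

∈-weightClass⁻ : ∀ {n} (R : Subset n) (w : Fin n → ℚ) (x : ℚ) {j} → j ∈ weightClass R w x → j ∈ R × w j ≡ x
∈-weightClass⁻ R w x j∈ =
  Product.map T-lookup⇒∈ (T-does⁻ (w _ ℚP.≟ x)) (Equivalence.to T-∧ (∈-tabulate⁻ (λ j → lookup R j ∧ does (w j ℚP.≟ x)) j∈))

∈-weightClass⁺ : ∀ {n} (R : Subset n) (w : Fin n → ℚ) (x : ℚ) {j} → j ∈ R → w j ≡ x → j ∈ weightClass R w x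
∈-weightClass⁺ R w x j∈R wj≡x =
  ∈-tabulate⁺ (λ j → lookup R j ∧ does (w j ℚP.≟ x)) (Equivalence.from T-∧ (∈⇒T-lookup j∈R , T-does⁺ (w _ ℚP.≟ x) wj≡x))

weightClasses-disjoint : ∀ {m n} (R : Subset n) (w : Fin n → ℚ) (v : Fin m → ℚ) →
  (∀ {s s′} → v s ≡ v s′ → s ≡ s′) → PairwiseDisjoint (λ s → weightClass R w (v s))
weightClasses-disjoint R w v v-injective s s′ s≢s′ (j , j∈∩) with x∈p∩q⁻ (weightClass R w (v s)) _ j∈∩
... | j∈Rₛ , j∈Rₛ′ =
  s≢s′ (v-injective (trans (sym (proj₂ (∈-weightClass⁻ R w (v s) j∈Rₛ))) (proj₂ (∈-weightClass⁻ R w (v s′) j∈Rₛ′))))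

wsum-weightClasses : ∀ {m n} (R : Subset n) (w : Fin n → ℚ) (v : Fin m → ℚ) →
  (∀ {s s′} → v s ≡ v s′ → s ≡ s′) → (∀ j → j ∈ R → ∃[ s ] w j ≡ v s) →
  wsum R w ≡ ∑[ s < m ] (ℕ→ℚ ∣ weightClass R w (v s) ∣ * v s)
wsum-weightClasses {m} {n} R w v v-injective covered = begin
  wsum R w                                        ≡⟨ cong (λ S → wsum S w) R≡⋃classes ⟩
  wsum (⋃ᶠ classes) w                              ≡⟨ wsum-⋃ᶠ classes w (weightClasses-disjoint R w v v-injective) ⟩
  ∑[ s < m ] wsum (classes s) w
    ≡⟨ sum-cong-≗ (λ s → wsum-const (classes s) w (λ j → proj₂ ∘ ∈-weightClass⁻ R w (v s))) ⟩
  ∑[ s < m ] (ℕ→ℚ ∣ classes s ∣ * v s)              ∎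
  where
  open ≡-Reasoning
  classes : Fin m → Subset n
  classes s = weightClass R w (v s)
  R≡⋃classes : R ≡ ⋃ᶠ classes
  R≡⋃classes = ⊆-antisym
    (λ {j} j∈R → let (s , wj≡vs) = covered j j∈R in ∈-⋃ᶠ⁺ classes s (∈-weightClass⁺ R w (v s) j∈R wj≡vs))
    (λ j∈⋃ → let (s , j∈Rₛ) = ∈-⋃ᶠ⁻ classes j∈⋃ in proj₁ (∈-weightClass⁻ R w (v s) j∈Rₛ))

wsum-⋃ᶠ-uniform : ∀ {m n} (A : Fin m → Subset n) (w : Fin n → ℚ) (v : Fin m → ℚ) →
  (∀ s j → j ∈ A s → w j ≡ v s) → PairwiseDisjoint A →
  wsum (⋃ᶠ A) w ≡ ∑[ s < m ] (ℕ→ℚ ∣ A s ∣ * v s)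
wsum-⋃ᶠ-uniform A w v uniform disjoint =
  trans (wsum-⋃ᶠ A w disjoint) (sum-cong-≗ (λ s → wsum-const (A s) w (uniform s)))

exponent-class : ∀ n .{{_ : ℕ.NonZero n}} k → 100 ℕ.≤ 5 ℕ.* 2 ^ k → 2 ^ k ℕ.≤ 2 ℕ.* n →
                 ∃[ s ] k ≡ 2 ℕ.+ toℕ {L n} s
exponent-class n zero 100≤5 _ = contradiction 100≤5 (from-no (100 ℕ.≤? 5))
exponent-class n (suc zero) 100≤10 _ = contradiction 100≤10 (from-no (100 ℕ.≤? 10))
exponent-class n (suc (suc k)) _ 2^k≤2n = fromℕ< k<L , cong (2 ℕ.+_) (sym (Fin.toℕ-fromℕ< k<L))
  where
  open ℕP.≤-Reasoning
  k<L : k ℕ.< L n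
  k<L = ℕ.s≤s⁻¹ (begin
    2 ℕ.+ k                   ≡⟨ ⌈log₂2^n⌉≡n (2 ℕ.+ k) ⟨
    ⌈log₂ 2 ^ (2 ℕ.+ k) ⌉     ≤⟨ ⌈log₂⌉-mono-≤ 2^k≤2n ⟩
    ⌈log₂ (2 ℕ.* n) ⌉         ≡⟨ ⌈log₂2*n⌉≡1+⌈log₂n⌉ n ⟩
    1 ℕ.+ L n                 ∎)

classWeight : ∀ {m} → Fin m → ℚ
classWeight s = pow2inv (2 ℕ.+ toℕ s)

classWeight-injective : ∀ {m} {s s′ : Fin m} → classWeight s ≡ classWeight s′ → s ≡ s′
classWeight-injective = Fin.toℕ-injective ∘ ℕP.suc-injective ∘ ℕP.suc-injective ∘ pow2inv-injective

weightCap : ℚ → ℚ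
weightCap α = ℕ→ℚ 5 ÷ᵣ (ℕ→ℚ 100 * α)

classWeight-covers : ∀ {n} {α} → 1ℚ ≤ α → Fin n → ∀ {x} → IsPowerOfTwo x →
  1ℚ ÷ᵣ ℕ→ℚ (2 ℕ.* n) ≤ x → x ≤ weightCap α → ∃[ s ] x ≡ classWeight {L n} s
classWeight-covers {n} {α} 1≤α j (k , refl) 1/2n≤x x≤cap =
  Product.map id (cong pow2inv) (exponent-class n k 100≤5*2^k 2^k≤2n)
  where
  open ℚP.≤-Reasoning
  instance
    n≢0 : ℕ.NonZero n
    n≢0 = Fin.nonZeroIndex j
  100≤5*2^k : 100 ℕ.≤ 5 ℕ.* 2 ^ k
  100≤5*2^k = *-pow2inv-≤⇒≤-*-2^ 100 5 k (begin
    ℕ→ℚ 100 * pow2inv k               ≡⟨ cong (_* pow2inv k) (ℚP.*-identityʳ (ℕ→ℚ 100)) ⟨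
    ℕ→ℚ 100 * 1ℚ * pow2inv k          ≤⟨ ℚP.*-monoʳ-≤-nonNeg (pow2inv k) {{ℚ.nonNegative (pow2inv-nonNeg k)}}
                                           (ℚP.*-monoˡ-≤-nonNeg (ℕ→ℚ 100) 1≤α) ⟩
    ℕ→ℚ 100 * α * pow2inv k           ≤⟨ ≤-÷ᵣ⇒*-≤ (*-pos (ℕ→ℚ-pos 100) (1≤⇒pos 1≤α)) x≤cap ⟩
    ℕ→ℚ 5                             ∎)
  2^k≤2n : 2 ^ k ℕ.≤ 2 ℕ.* n
  2^k≤2n = ℕP.≤-trans (ℕP.≤-reflexive (sym (ℕP.*-identityˡ (2 ^ k))))
    (≤-*-pow2inv⇒*-2^-≤ 1 (2 ℕ.* n) k (÷ᵣ-≤⇒≤-* (ℕ→ℚ-pos (2 ℕ.* n) {{ℕP.m*n≢0 2 n}}) 1/2n≤x))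

floor-share-≤ : ∀ {α x} → 1ℚ ≤ α → 0ℚ ≤ x → ∀ m a → ℚ.floor (ℕ→ℚ m ÷ᵣ α) ℤ.≤ + a →
                ℕ→ℚ m * x ≤ α * (ℕ→ℚ a * x + x)
floor-share-≤ {α} {x} 1≤α 0≤x m a ⌊m/α⌋≤a = begin
  ℕ→ℚ m * x                ≤⟨ ℚP.*-monoʳ-≤-nonNeg x {{ℚ.nonNegative 0≤x}}
                                (÷ᵣ-≤⇒≤-* (1≤⇒pos 1≤α) (floor≤⇒≤suc _ a ⌊m/α⌋≤a)) ⟩
  α * ℕ→ℚ (suc a) * x      ≡⟨ cong (λ c → α * c * x) (ℕ→ℚ-+ 1 a) ⟩
  α * (1ℚ + ℕ→ℚ a) * x     ≡⟨ solve 3 (λ α a x → α :* (con 1ℚ :+ a) :* x := α :* (a :* x :+ x)) refl α (ℕ→ℚ a) x ⟩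
  α * (ℕ→ℚ a * x + x)      ∎
  where open ℚP.≤-Reasoning

class-share-≤ : ∀ {n α x} → 1ℚ ≤ α → 0ℚ ≤ x → (C A : Subset n) → ℚ.floor (ℕ→ℚ ∣ C ∣ ÷ᵣ α) ℤ.≤ + ∣ A ∣ →
  ℕ→ℚ ∣ C ∣ * x ≤ α * (ℕ→ℚ ∣ A ∣ * x + (if does (nonempty? C) then x else 0ℚ))
class-share-≤ 1≤α 0≤x C A ⌊C/α⌋≤A with nonempty? C
... | yes _ = floor-share-≤ 1≤α 0≤x ∣ C ∣ ∣ A ∣ ⌊C/α⌋≤A
class-share-≤ {n} {α} {x} 1≤α 0≤x C A _ | no C-empty = begin
  ℕ→ℚ ∣ C ∣ * x            ≡⟨ cong (λ c → ℕ→ℚ c * x) (trans (cong ∣_∣ (Empty-unique C-empty)) (∣⊥∣≡0 n)) ⟩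
  0ℚ * x                   ≡⟨ ℚP.*-zeroˡ x ⟩
  0ℚ                       ≤⟨ *-nonNeg (ℚP.<⇒≤ (1≤⇒pos 1≤α))
                               (ℚP.+-mono-≤ (*-nonNeg (ℕ→ℚ-nonNeg ∣ A ∣) 0≤x) ℚP.≤-refl) ⟩
  α * (ℕ→ℚ ∣ A ∣ * x + 0ℚ) ∎
  where open ℚP.≤-Reasoning

configuration-weight-≤ : ∀ {n α} → 1ℚ ≤ α → (R : Subset n) (w : Fin n → ℚ) →
  (∀ j → j ∈ R → IsPowerOfTwo (w j) × (1ℚ ÷ᵣ ℕ→ℚ (2 ℕ.* n) ≤ w j) × (w j ≤ weightCap α)) →
  (A : Fin (L n) → Subset n) → (∀ s → A s ⊆ weightClass R w (classWeight s)) →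
  (∀ s → ℚ.floor (ℕ→ℚ ∣ weightClass R w (classWeight s) ∣ ÷ᵣ α) ℤ.≤ + ∣ A s ∣) → PairwiseDisjoint A →
  wsum R w ≤ α * (wsum (⋃ᶠ A) w + (weightCap α + weightCap α))
configuration-weight-≤ {n} {α} 1≤α R w bounded A A⊆C A-large A-disjoint = begin
  wsum R w                                              ≡⟨ wsum-weightClasses R w classWeight classWeight-injective covered ⟩
  ∑[ s < L n ] (ℕ→ℚ ∣ C s ∣ * classWeight s)             ≤⟨ ∑-mono-≤ share-≤ ⟩
  ∑[ s < L n ] (α * (ℕ→ℚ ∣ A s ∣ * classWeight s + e s)) ≡⟨ *-distribˡ-sum α (λ s → ℕ→ℚ ∣ A s ∣ * classWeight s + e s) ⟨
  α * ∑[ s < L n ] (ℕ→ℚ ∣ A s ∣ * classWeight s + e s)   ≡⟨ cong (α *_) (∑-distrib-+ _ e) ⟩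
  α * (∑[ s < L n ] (ℕ→ℚ ∣ A s ∣ * classWeight s) + ∑[ s < L n ] e s)
    ≤⟨ ℚP.*-monoˡ-≤-nonNeg α {{ℚ.nonNegative (ℚP.<⇒≤ 0<α)}} (ℚP.+-mono-≤ (ℚP.≤-reflexive ∑A≡wsum⋃A) ∑e≤2c) ⟩
  α * (wsum (⋃ᶠ A) w + (weightCap α + weightCap α))     ∎
  where
  open ℚP.≤-Reasoning
  0<α : 0ℚ < α
  0<α = 1≤⇒pos 1≤α
  C : Fin (L n) → Subset n
  C s = weightClass R w (classWeight s)
  e : Fin (L n) → ℚ
  e s = if does (nonempty? (C s)) then classWeight s else 0ℚ
  covered : ∀ j → j ∈ R → ∃[ s ] w j ≡ classWeight s
  covered j j∈R = let (2^ , lo , hi) = bounded j j∈R in classWeight-covers 1≤α j 2^ lo hi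
  share-≤ : ∀ s → ℕ→ℚ ∣ C s ∣ * classWeight s ≤ α * (ℕ→ℚ ∣ A s ∣ * classWeight s + e s)
  share-≤ s = class-share-≤ 1≤α (pow2inv-nonNeg (2 ℕ.+ toℕ s)) (C s) (A s) (A-large s)
  ∑A≡wsum⋃A : ∑[ s < L n ] (ℕ→ℚ ∣ A s ∣ * classWeight s) ≡ wsum (⋃ᶠ A) w
  ∑A≡wsum⋃A = sym (wsum-⋃ᶠ-uniform A w classWeight
    (λ s j j∈Aₛ → proj₂ (∈-weightClass⁻ R w (classWeight s) (A⊆C s j∈Aₛ))) A-disjoint)
  nonempty-class≤cap : ∀ s → T (does (nonempty? (C s))) → classWeight s ≤ weightCap α
  nonempty-class≤cap s t = let (j , j∈Cₛ) = T-does⁻ (nonempty? (C s)) t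
                               (j∈R , wj≡v) = ∈-weightClass⁻ R w (classWeight s) j∈Cₛ
                           in subst (_≤ weightCap α) wj≡v (proj₂ (proj₂ (bounded j j∈R)))
  ∑e≤2c : ∑[ s < L n ] e s ≤ weightCap α + weightCap α
  ∑e≤2c = ∑-selected-halving-≤ ((pow2inv-nonNeg ∘ suc ∘ suc) , (pow2inv-halves ∘ suc ∘ suc))
    (λ s → does (nonempty? (C s))) (÷ᵣ-nonNeg (*-pos (ℕ→ℚ-pos 100) 0<α) (ℕ→ℚ-nonNeg 5)) nonempty-class≤cap

-- The slack α (c + c) = 1/10 left by the cap c = 5/(100 α) costs less than a factor 2.
relaxation-≤ : ∀ {α W} → 0ℚ < α → 1ℚ ≤ α * (W + (weightCap α + weightCap α)) → 1ℚ ÷ᵣ (ℕ→ℚ 2 * α) ≤ W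
relaxation-≤ {α} {W} 0<α 1≤α[W+2c] = ≤-*⇒÷ᵣ-≤ (*-pos (ℕ→ℚ-pos 2) 0<α) (+-cancelʳ-≤ 1ℚ (begin
  1ℚ + 1ℚ                                   ≤⟨ ℚP.+-mono-≤ 1≤α[W+2c] 1≤α[W+2c] ⟩
  α * (W + (c + c)) + α * (W + (c + c))     ≡⟨ solve 3 (λ α W c → α :* (W :+ (c :+ c)) :+ α :* (W :+ (c :+ c))
                                                := con (ℕ→ℚ 2) :* α :* W :+ (α :* (c :+ c) :+ α :* (c :+ c))) refl α W c ⟩
  ℕ→ℚ 2 * α * W + (h + h)                   ≤⟨ ℚP.+-monoʳ-≤ (ℕ→ℚ 2 * α * W) h+h≤1 ⟩
  ℕ→ℚ 2 * α * W + 1ℚ                        ∎))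
  where
  open ℚP.≤-Reasoning
  c h : ℚ
  c = weightCap α
  h = α * (c + c)
  h+h≤1 : h + h ≤ 1ℚ
  h+h≤1 = ℚP.*-cancelʳ-≤-pos (ℕ→ℚ 25) (begin
    (h + h) * ℕ→ℚ 25                ≡⟨ solve 2 (λ α c → (α :* (c :+ c) :+ α :* (c :+ c)) :* con (ℕ→ℚ 25)
                                                   := con (ℕ→ℚ 100) :* α :* c) refl α c ⟩
    ℕ→ℚ 100 * α * c                 ≡⟨ *-÷ᵣ-inverse (*-pos (ℕ→ℚ-pos 100) 0<α) ⟩
    ℕ→ℚ 5                           ≤⟨ ℕ→ℚ-mono-≤ (ℕP.m≤m+n 5 20) ⟩
    ℕ→ℚ 25                          ≡⟨ ℚP.*-identityˡ (ℕ→ℚ 25) ⟨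
    1ℚ * ℕ→ℚ 25                     ∎)

induced-matching : ∀ (α : ℚ) → 1ℚ ≤ α → (n : ℕ) (H : WHypergraph n) →
  WellFormed α H → (M′ : ConsistentRelaxedPM H α) → Σ[ M ∈ RelaxedPM H (ℕ→ℚ 2 * α) ] Induces M′ M
induced-matching α 1≤α n H (bounded , normalised) M′ = M , (λ _ → refl) , (λ i _ → ∈-⋃ᶠ⁻ (group i))
  where
  open WHypergraph H
  module M′ = ConsistentRelaxedPM M′
  group : Fin nP → Fin (L n) → Subset n
  group i s = M′.assign (i , s)
  group-⊆ : ∀ i → ⋃ᶠ (group i) ⊆ res (M′.choice i)
  group-⊆ i j∈⋃ = let (s , j∈Aₛ) = ∈-⋃ᶠ⁻ (group i) j∈⋃
                  in proj₁ (∈-weightClass⁻ (res c) (weight c) (classWeight s) (M′.assign-⊆ i s j∈Aₛ))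
    where c = M′.choice i
  group-weight : ∀ i → let c = M′.choice i in
                 wsum (res c) (weight c) ÷ᵣ (ℕ→ℚ 2 * α) ≤ wsum (⋃ᶠ (group i)) (weight c)
  group-weight i = ℚP.≤-trans (ℚP.≤-reflexive (cong (_÷ᵣ (ℕ→ℚ 2 * α)) (normalised c)))
    (relaxation-≤ (1≤⇒pos 1≤α) (ℚP.≤-trans (ℚP.≤-reflexive (sym (normalised c)))
      (configuration-weight-≤ 1≤α (res c) (weight c) (bounded c) (group i) (M′.assign-⊆ i) (M′.assign-size i)
        (λ s s′ s≢s′ → M′.disjoint (i , s) (i , s′) (s≢s′ ∘ cong proj₂)))))
    where c = M′.choice i
  groups-disjoint : ∀ i i′ → i ≢ i′ → Empty (⋃ᶠ (group i) ∩ ⋃ᶠ (group i′))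
  groups-disjoint i i′ i≢i′ (j , j∈∩) =
    let (j∈⋃ , j∈⋃′) = x∈p∩q⁻ (⋃ᶠ (group i)) (⋃ᶠ (group i′)) j∈∩
        (s , j∈Aₛ) = ∈-⋃ᶠ⁻ (group i) j∈⋃
        (s′ , j∈A′ₛ′) = ∈-⋃ᶠ⁻ (group i′) j∈⋃′
    in M′.disjoint (i , s) (i′ , s′) (i≢i′ ∘ cong proj₁) (j , x∈p∩q⁺ (j∈Aₛ , j∈A′ₛ′))
  M : RelaxedPM H (ℕ→ℚ 2 * α)
  M = record
    { choice = M′.choice ; choice-player = M′.choice-player ; assign = ⋃ᶠ ∘ group
    ; assign-⊆ = group-⊆ ; assign-weight = group-weight ; disjoint = groups-disjoint }

lemma3 : ∃[ c ] (1ℚ ≤ c × (∀ (α : ℚ) → 1ℚ ≤ α → (n : ℕ) (H : WHypergraph n) →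
           WellFormed α H → (M′ : ConsistentRelaxedPM H α) →
           Σ[ M ∈ RelaxedPM H (c * α) ] Induces M′ M))
lemma3 = ℕ→ℚ 2 , ℕ→ℚ-mono-≤ (s≤s z≤n) , induced-matching
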